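{- Let $w$ be a prefix-shuffle, $\mathcal T=\theta(\lambda_1(w))$, and $\mathcal T_\alpha=\theta(\lambda_1(w\alpha))$ for $\alpha\in\{a,b,\bar a,\bar b\}$. Then: (i) $\mathcal T_a$ is obtained from $\mathcal T$ by adding a new leaf which becomes the first active right vertex; this leaf is the leftmost son of the last active left vertex; (ii) $\mathcal T_b$ is obtained from $\mathcal T$ by adding a new leaf which becomes the last active left vertex; this leaf is the rightmost son of the first active right vertex; (iii) $\mathcal T_{\bar a}$ is obtained from $\mathcal T$ by inactivating the first active right vertex; (iv) $\mathcal T_{\bar b}$ is obtained from $\mathcal T$ by inactivating the last active left vertex.
   Context: A prefix-shuffle is a word $w$ on $\{a,\bar a,b,\bar b\}$ such that every prefix $w'$ satisfies $|w'|_a\ge|w'|_{\bar a}$ and $|w'|_b\ge|w'|_{\bar b}$. A binary tree is a planted plane tree each of whose vertices is a node (degree 3) or a leaf (degree 1); counterclockwise around a node one finds its father (or the root), its left son, its right son. Leaves are left or right according to being left or right sons, and each leaf is active or inactive. Vertices are ordered by order of appearance in the tour (following the border counterclockwise from the root). $B_1$ is the binary tree with a root, one node and two active leaves. $\lambda_1$ is defined recursively: $\lambda_1(\epsilon)=B_1$; $\lambda_1(w'a)$: replace the last active left leaf of $\lambda_1(w')$ by $B_1$; $\lambda_1(w'b)$: replace the first active right leaf by $B_1$; $\lambda_1(w'\bar a)$: inactivate the first active right leaf; $\lambda_1(w'\bar b)$: inactivate the last active left leaf. An edge of a binary tree is branching if one endpoint is a right son and the other is a left son or the root-vertex; $\theta(B)$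 is obtained by contracting every non-branching edge. Correspondence leaves of $B$ / vertices of $\theta(B)$: the first left leaf corresponds to the root-vertex of $\theta(B)$; any other leaf $l$ is the endpoint of a maximal initial run of edges of the same side (all left or all right) on its path to the root, whose last edge $e(l)$ is branching, and $l$ corresponds to the son-endpoint of $e(l)$ in $\theta(B)$. A vertex of $\theta(\lambda_1(w))$ is called left/right/active/inactive if its corresponding leaf is, and vertices inherit the order of their leaves. In a tree, the leftmost (resp. rightmost) son of a non-leaf vertex $v$ is the son following (resp. preceding) the father of $v$ (or the root) in counterclockwise order around $v$. -}

module Defs where

open import Data.Nat using (ℕ; zero; suc; _+_; _∸_; _≤_; _<ᵇ_)
open import Data.Bool using (Bool; true; false; if_then_else_; _∧_; not)
open import Data.List using (List; []; _∷_; _++_; [_])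
open import Data.Maybe using (Maybe; just; nothing)
open import Data.Product using (_×_; _,_; Σ)
open import Relation.Binary.PropositionalEquality using (_≡_)

data Letter : Set where
  a abar b bbar : Letter

eqL : Letter → Letter → Bool
eqL a    a    = true
eqL abar abar = true
eqL b    b    = true
eqL bbar bbar = true
eqL _    _    = false

count : Letter → List Letter → ℕ
count x []      = 0
count x (y ∷ u) = if eqL x y then suc (count x u) else count x u

PrefixShuffle : List Letter → Set
PrefixShuffle w = ∀ (u v : List Letter) → w ≡ u ++ v →
  (count abar u ≤ count a u) × (count bbar u ≤ count b u)

-- Binary trees (planted plane trees with nodes of degree 3 and leaves).
-- The root-vertex (degree 1) is implicit above the top vertex.
-- A leaf carries its activity flag (true = active).

data BT : Set where
  lf : Bool → BT
  nd : BT → BT → BT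

data Side : Set where
  L R : Side

B₁ : BT
B₁ = nd (lf true) (lf true)

size : BT → ℕ
size (lf _)   = 1
size (nd l r) = size l + size r

-- leaves in the order of the tour (left to right), with side and activity.
-- The argument is the side of the subtree's top vertex (a leaf's side is
-- the side it is a son of).
leafInfo : Side → BT → List (Side × Bool)
leafInfo s (lf x)   = [ (s , x) ]
leafInfo s (nd l r) = leafInfo L l ++ leafInfo R r

leaves : BT → List (Side × Bool)
leaves = leafInfo L

isActive : Side → Side × Bool → Bool
isActive L (L , x) = x
isActive R (R , x) = x
isActive _ _       = false

firstIndex : {A : Set} → (A → Bool) → List A → Maybe ℕ
firstIndex p []       = nothing
firstIndex p (x ∷ xs) = if p x then just 0 else Data.Maybe.map suc (firstIndex p xs)
  where import Data.Maybe

lastIndex : {A : Set} → (A → Bool) → List A → Maybe ℕ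
lastIndex p []       = nothing
lastIndex p (x ∷ xs) with lastIndex p xs
... | just i  = just (suc i)
... | nothing = if p x then just 0 else nothing

modifyLeaf : ℕ → (Bool → BT) → BT → BT
modifyLeaf zero    f (lf x) = f x
modifyLeaf (suc i) f (lf x) = lf x
modifyLeaf i f (nd l r) =
  if i <ᵇ size l then nd (modifyLeaf i f l) r
                 else nd l (modifyLeaf (i ∸ size l) f r)

onLeaf : Maybe ℕ → (Bool → BT) → BT → BT
onLeaf (just i) f t = modifyLeaf i f t
onLeaf nothing  f t = t

step : BT → Letter → BT
step t a    = onLeaf (lastIndex  (isActive L) (leaves t)) (λ _ → B₁)       t
step t b    = onLeaf (firstIndex (isActive R) (leaves t)) (λ _ → B₁)       t
step t abar = onLeaf (firstIndex (isActive R) (leaves t)) (λ _ → lf false) t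
step t bbar = onLeaf (lastIndex  (isActive L) (leaves t)) (λ _ → lf false) t

λ₁ : List Letter → BT
λ₁ w = go B₁ w
  where
  go : BT → List Letter → BT
  go t []      = t
  go t (x ∷ u) = go (step t x) u

-- Plane trees (arbitrary degrees), vertices labelled by
-- (side , active? , position in the inherited order).

Label : Set
Label = Side × Bool × ℕ

data PT : Set where
  pt : Label → List PT → PT    -- children listed from leftmost to rightmost son

appendChild : PT → PT → PT
appendChild (pt x cs) c = pt x (cs ++ [ c ])

consChild : PT → PT → PT
consChild c (pt x cs) = pt x (c ∷ cs)

-- A class of vertices of B joined by
-- non-branching edges is a maximal left spine (top vertex a left son, or
-- the root-vertex together with the top node) or a maximal right spine;
-- it is labelled by the leaf at the bottom of the spine (the leaf that
-- corresponds to it), with that leaf's side, activity and position o in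
-- the leaf order of B.  Counterclockwise around a contracted left spine
-- one meets (after the father) the right subtrees from the bottom up;
-- around a contracted right spine the left subtrees from the top down.
mutual
  θL : ℕ → BT → PT
  θL o (lf x)   = pt (L , x , o) []
  θL o (nd l r) = appendChild (θL o l) (θR (o + size l) r)

  θR : ℕ → BT → PT
  θR o (lf x)   = pt (R , x , o) []
  θR o (nd l r) = consChild (θL o l) (θR (o + size l) r)

θ : BT → PT
θ = θL 0

-- Vertices of plane trees addressed by paths (lists of son indices,
-- 0 = leftmost son).

Path : Set
Path = List ℕ

mutual
  lookupPT : PT → Path → Maybe Label
  lookupPT (pt x cs) []      = just x
  lookupPT (pt x cs) (i ∷ p) = lookupCs cs i p

  lookupCs : List PT → ℕ → Path → Maybe Label
  lookupCs []       i       p = nothing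
  lookupCs (c ∷ cs) zero    p = lookupPT c p
  lookupCs (c ∷ cs) (suc i) p = lookupCs cs i p

mutual
  modifyAt : Path → (PT → PT) → PT → PT
  modifyAt []      f t         = f t
  modifyAt (i ∷ p) f (pt x cs) = pt x (modifyCs i p f cs)

  modifyCs : ℕ → Path → (PT → PT) → List PT → List PT
  modifyCs i       p f []       = []
  modifyCs zero    p f (c ∷ cs) = modifyAt p f c ∷ cs
  modifyCs (suc i) p f (c ∷ cs) = c ∷ modifyCs i p f cs

addLeftmost : Path → Label → PT → PT
addLeftmost p x = modifyAt p (λ { (pt y cs) → pt y (pt x [] ∷ cs) })

addRightmost : Path → Label → PT → PT
addRightmost p x = modifyAt p (λ { (pt y cs) → pt y (cs ++ [ pt x [] ]) })

inactivate : Path → PT → PT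
inactivate p = modifyAt p (λ { (pt (s , _ , k) cs) → pt (s , false , k) cs })

shiftIdx : ℕ → ℕ → ℕ
shiftIdx i j = if j <ᵇ i then j else suc j

mutual
  shiftFrom : ℕ → PT → PT
  shiftFrom i (pt (s , x , k) cs) = pt (s , x , shiftIdx i k) (shiftCs i cs)

  shiftCs : ℕ → List PT → List PT
  shiftCs i []       = []
  shiftCs i (c ∷ cs) = shiftFrom i c ∷ shiftCs i cs

IsLastActiveLeft : PT → Path → ℕ → Set
IsLastActiveLeft T p k =
  (lookupPT T p ≡ just (L , true , k)) ×
  (∀ (q : Path) (j : ℕ) → lookupPT T q ≡ just (L , true , j) → j ≤ k)

IsFirstActiveRight : PT → Path → ℕ → Set
IsFirstActiveRight T p k =
  (lookupPT T p ≡ just (R , true , k)) ×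
  (∀ (q : Path) (j : ℕ) → lookupPT T q ≡ just (R , true , j) → k ≤ j)

𝒯 : List Letter → PT
𝒯 w = θ (λ₁ w)

{-# OPTIONS --safe #-}
-- λ₁ only ever replaces one leaf of the binary tree, by B₁ or by an inactive leaf, and θ sends
-- the m-th leaf to the vertex at an explicit path (leafPath).  Replacing that leaf therefore acts
-- on θ locally: positions after m are shifted, and the vertex of the leaf gains a son (the
-- leftmost one for a left leaf, the rightmost one for a right leaf) or is inactivated.  That the
-- new son is the first active right (last active left) vertex rests on an invariant of λ₁: every
-- active left leaf precedes every active right leaf.  A second invariant counts the active left
-- and right leaves as 1 + |w|_b - |w|_b̄ and 1 + |w|_a - |w|_ā; for a prefix-shuffle both are
-- positive, so the leaves that λ₁ acts on exist.
module Submission where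

open import Defs
open import Data.Nat using (ℕ; zero; suc; _+_; _∸_; _≤_; _<_; _<ᵇ_; z≤n; s≤s)
open import Data.Nat.Properties
open import Algebra.Properties.CommutativeSemigroup +-commutativeSemigroup
  using (x∙yz≈y∙xz; xy∙z≈xz∙y; x∙yz≈xz∙y)
open import Data.Bool using (Bool; true; false; if_then_else_; T)
open import Data.Bool.Properties using (T-≡)
open import Data.Unit using (tt)
open import Data.List using (List; []; _∷_; _++_; [_]; length; foldl)
open import Data.List.Properties using (length-++; ++-assoc; ++-identityʳ; foldl-∷ʳ)
open import Data.List.Reverse using (Reverse; []; _∶_∶ʳ_; reverseView)
open import Data.Maybe using (Maybe; just; nothing)
open import Data.Product using (_×_; _,_; Σ; proj₁; proj₂)
open import Data.Sum using (_⊎_; inj₁; inj₂)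
open import Data.Empty using (⊥; ⊥-elim)
open import Function.Bundles using (Equivalence)
open import Relation.Binary using (tri<; tri≈; tri>)
open import Relation.Binary.PropositionalEquality
  using (_≡_; _≢_; refl; sym; trans; cong; cong₂; subst; subst₂; module ≡-Reasoning)
open ≡-Reasoning

<⇒<ᵇ≡true : ∀ {m n} → m < n → (m <ᵇ n) ≡ true
<⇒<ᵇ≡true m<n = Equivalence.to T-≡ (<⇒<ᵇ m<n)

≥⇒<ᵇ≡false : ∀ {m n} → n ≤ m → (m <ᵇ n) ≡ false
≥⇒<ᵇ≡false {m} {n} n≤m with m <ᵇ n in eq
... | false = refl
... | true  = ⊥-elim (≤⇒≯ n≤m (<ᵇ⇒< m n (subst T (sym eq) tt)))

leafAt : Side → BT → ℕ → Maybe (Side × Bool)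
leafAt s (lf x)   zero    = just (s , x)
leafAt s (lf x)   (suc m) = nothing
leafAt s (nd l r) m       = if m <ᵇ size l then leafAt L l m else leafAt R r (m ∸ size l)

leafAt-nd-< : ∀ s l r {m} → m < size l → leafAt s (nd l r) m ≡ leafAt L l m
leafAt-nd-< s l r m<l rewrite <⇒<ᵇ≡true m<l = refl

leafAt-nd-≥ : ∀ s l r {m} → size l ≤ m → leafAt s (nd l r) m ≡ leafAt R r (m ∸ size l)
leafAt-nd-≥ s l r l≤m rewrite ≥⇒<ᵇ≡false l≤m = refl

leafAt⇒<size : ∀ s t m {y} → leafAt s t m ≡ just y → m < size t
leafAt⇒<size s (lf x)   zero    _ = s≤s z≤n
leafAt⇒<size s (nd l r) m       e with <-≤-connex m (size l)
... | inj₁ m<l = <-≤-trans m<l (m≤m+n (size l) (size r))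
... | inj₂ l≤m = subst (_< size l + size r) (m+[n∸m]≡n l≤m)
  (+-monoʳ-< (size l) (leafAt⇒<size R r (m ∸ size l) (trans (sym (leafAt-nd-≥ s l r l≤m)) e)))

leafAt-≥size : ∀ s t m → size t ≤ m → leafAt s t m ≡ nothing
leafAt-≥size s (lf x)   (suc m) _ = refl
leafAt-≥size s (nd l r) m       t≤m
  rewrite ≥⇒<ᵇ≡false (≤-trans (m≤m+n (size l) (size r)) t≤m) =
  leafAt-≥size R r (m ∸ size l)
    (subst (_≤ m ∸ size l) (m+n∸m≡n (size l) (size r)) (∸-monoˡ-≤ (size l) t≤m))

-- Unlike modifyLeaf, this inspects the tree first, so it computes on nd l r for an unknown index.
replaceLeaf : (Bool → BT) → BT → ℕ → BT
replaceLeaf f (lf x)   zero    = f x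
replaceLeaf f (lf x)   (suc m) = lf x
replaceLeaf f (nd l r) m       =
  if m <ᵇ size l then nd (replaceLeaf f l m) r else nd l (replaceLeaf f r (m ∸ size l))

modifyLeaf≡replaceLeaf : ∀ m f t → modifyLeaf m f t ≡ replaceLeaf f t m
modifyLeaf≡replaceLeaf zero    f (lf x)   = refl
modifyLeaf≡replaceLeaf (suc m) f (lf x)   = refl
modifyLeaf≡replaceLeaf zero    f (nd l r) = cong₂ (λ l′ r′ → if 0 <ᵇ size l then nd l′ r else nd l r′)
  (modifyLeaf≡replaceLeaf 0 f l) (modifyLeaf≡replaceLeaf (0 ∸ size l) f r)
modifyLeaf≡replaceLeaf (suc m) f (nd l r) = cong₂ (λ l′ r′ → if suc m <ᵇ size l then nd l′ r else nd l r′)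
  (modifyLeaf≡replaceLeaf (suc m) f l) (modifyLeaf≡replaceLeaf (suc m ∸ size l) f r)

countᵇ : {A : Set} → (A → Bool) → List A → ℕ
countᵇ p []       = 0
countᵇ p (y ∷ ys) = if p y then suc (countᵇ p ys) else countᵇ p ys

countᵇ-++ : ∀ {A : Set} (p : A → Bool) xs ys → countᵇ p (xs ++ ys) ≡ countᵇ p xs + countᵇ p ys
countᵇ-++ p []       ys = refl
countᵇ-++ p (x ∷ xs) ys with p x
... | true  = cong suc (countᵇ-++ p xs ys)
... | false = countᵇ-++ p xs ys

nth : {A : Set} → ℕ → List A → Maybe A
nth i       []       = nothing
nth zero    (x ∷ xs) = just x
nth (suc i) (x ∷ xs) = nth i xs

nth-++ : ∀ {A : Set} j (xs ys : List A) →
  nth j (xs ++ ys) ≡ (if j <ᵇ length xs then nth j xs else nth (j ∸ length xs) ys)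
nth-++ j       []       ys = refl
nth-++ zero    (x ∷ xs) ys = refl
nth-++ (suc j) (x ∷ xs) ys = nth-++ j xs ys

length-leafInfo : ∀ s t → length (leafInfo s t) ≡ size t
length-leafInfo s (lf x)   = refl
length-leafInfo s (nd l r) = trans (length-++ (leafInfo L l)) (cong₂ _+_ (length-leafInfo L l) (length-leafInfo R r))

nth-leafInfo : ∀ s t j → nth j (leafInfo s t) ≡ leafAt s t j
nth-leafInfo s (lf x)   zero    = refl
nth-leafInfo s (lf x)   (suc j) = refl
nth-leafInfo s (nd l r) j rewrite nth-++ j (leafInfo L l) (leafInfo R r) | length-leafInfo L l
                                | nth-leafInfo L l j | nth-leafInfo R r (j ∸ size l) = refl

module _ {A : Set} (p : A → Bool) where

  countᵇ-witness : ∀ xs → countᵇ p xs ≢ 0 → Σ ℕ λ j → Σ A λ y → (nth j xs ≡ just y) × (p y ≡ true)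
  countᵇ-witness []       c≢0 = ⊥-elim (c≢0 refl)
  countᵇ-witness (x ∷ xs) c≢0 with p x in px
  ... | true  = 0 , x , refl , px
  ... | false with countᵇ-witness xs c≢0
  ...   | j , y , e , py = suc j , y , e , py

  lastIndex-nothing : ∀ xs → lastIndex p xs ≡ nothing → ∀ j {y} → nth j xs ≡ just y → p y ≡ false
  lastIndex-nothing (x ∷ xs) e j h with lastIndex p xs in eq
  lastIndex-nothing (x ∷ xs) e j h | nothing with p x in px
  lastIndex-nothing (x ∷ xs) e zero    refl | nothing | false = px
  lastIndex-nothing (x ∷ xs) e (suc j) h    | nothing | false = lastIndex-nothing xs eq j h

  lastIndex-just : ∀ xs {m} → lastIndex p xs ≡ just m →
    Σ A (λ y → (nth m xs ≡ just y) × (p y ≡ true)) ×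
    (∀ j {y} → nth j xs ≡ just y → p y ≡ true → j ≤ m)
  lastIndex-just (x ∷ xs) e with lastIndex p xs in eq
  lastIndex-just (x ∷ xs) refl | just i with lastIndex-just xs eq
  ... | found , maximal = found , λ { zero _ _ → z≤n ; (suc j) h py → s≤s (maximal j h py) }
  lastIndex-just (x ∷ xs) e | nothing with p x in px
  lastIndex-just (x ∷ xs) refl | nothing | true = (x , refl , px) , maximal
    where
      maximal : ∀ j {y} → nth j (x ∷ xs) ≡ just y → p y ≡ true → j ≤ 0
      maximal zero    _ _  = z≤n
      maximal (suc j) h py with () ← trans (sym py) (lastIndex-nothing xs eq j h)

  firstIndex-nothing : ∀ xs → firstIndex p xs ≡ nothing → ∀ j {y} → nth j xs ≡ just y → p y ≡ false
  firstIndex-nothing (x ∷ xs) e j h with p x in px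
  firstIndex-nothing (x ∷ xs) e j h | false with firstIndex p xs in eq
  firstIndex-nothing (x ∷ xs) e zero    refl | false | nothing = px
  firstIndex-nothing (x ∷ xs) e (suc j) h    | false | nothing = firstIndex-nothing xs eq j h

  firstIndex-just : ∀ xs {m} → firstIndex p xs ≡ just m →
    Σ A (λ y → (nth m xs ≡ just y) × (p y ≡ true)) ×
    (∀ j {y} → nth j xs ≡ just y → p y ≡ true → m ≤ j)
  firstIndex-just (x ∷ xs) e with p x in px
  firstIndex-just (x ∷ xs) refl | true = (x , refl , px) , λ _ _ _ → z≤n
  firstIndex-just (x ∷ xs) e | false with firstIndex p xs in eq
  firstIndex-just (x ∷ xs) refl | false | just i with firstIndex-just xs eq
  ... | found , minimal = found , minimal′
    where
      minimal′ : ∀ j {y} → nth j (x ∷ xs) ≡ just y → p y ≡ true → suc i ≤ j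
      minimal′ zero    refl py with () ← trans (sym py) px
      minimal′ (suc j) h    py = s≤s (minimal j h py)

module Replacement (f : Bool → BT) (d : ℕ) (size-f : ∀ x → size (f x) ≡ suc d) where

  size-replaceLeaf : ∀ s t m {y} → leafAt s t m ≡ just y → size (replaceLeaf f t m) ≡ d + size t
  size-replaceLeaf s (lf x)   zero _ = trans (size-f x) (+-comm 1 d)
  size-replaceLeaf s (nd l r) m    e with <-≤-connex m (size l)
  ... | inj₁ m<l rewrite <⇒<ᵇ≡true m<l =
    trans (cong (_+ size r) (size-replaceLeaf L l m e)) (+-assoc d (size l) (size r))
  ... | inj₂ l≤m rewrite ≥⇒<ᵇ≡false l≤m =
    trans (cong (size l +_) (size-replaceLeaf R r (m ∸ size l) e)) (x∙yz≈y∙xz (size l) d (size r))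

  leafAt-replaceLeaf-< : ∀ s t m j {y} → leafAt s t m ≡ just y → j < m →
    leafAt s (replaceLeaf f t m) j ≡ leafAt s t j
  leafAt-replaceLeaf-< s (lf x)   zero    j _ ()
  leafAt-replaceLeaf-< s (nd l r) m       j e j<m with <-≤-connex m (size l)
  ... | inj₁ m<l rewrite <⇒<ᵇ≡true m<l | size-replaceLeaf L l m e
                       | <⇒<ᵇ≡true (<-trans j<m m<l)
                       | <⇒<ᵇ≡true (<-≤-trans (<-trans j<m m<l) (m≤n+m (size l) d)) =
    leafAt-replaceLeaf-< L l m j e j<m
  ... | inj₂ l≤m rewrite ≥⇒<ᵇ≡false l≤m with <-≤-connex j (size l)
  ...   | inj₁ j<l rewrite <⇒<ᵇ≡true j<l = refl
  ...   | inj₂ l≤j rewrite ≥⇒<ᵇ≡false l≤j =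
    leafAt-replaceLeaf-< R r (m ∸ size l) (j ∸ size l) e (∸-monoˡ-< j<m l≤j)

  leafAt-replaceLeaf-> : ∀ s t m j {y} → leafAt s t m ≡ just y → m < j →
    leafAt s (replaceLeaf f t m) (d + j) ≡ leafAt s t j
  leafAt-replaceLeaf-> s (lf x)   zero    (suc j) _ _ =
    leafAt-≥size s (f x) (d + suc j) (subst₂ _≤_ (sym (size-f x)) (sym (+-suc d j)) (s≤s (m≤m+n d j)))
  leafAt-replaceLeaf-> s (nd l r) m       j e m<j with <-≤-connex m (size l)
  ... | inj₁ m<l rewrite <⇒<ᵇ≡true m<l | size-replaceLeaf L l m e with <-≤-connex j (size l)
  ...   | inj₁ j<l rewrite <⇒<ᵇ≡true j<l | <⇒<ᵇ≡true (+-monoʳ-< d j<l) =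
    leafAt-replaceLeaf-> L l m j e m<j
  ...   | inj₂ l≤j rewrite ≥⇒<ᵇ≡false l≤j | ≥⇒<ᵇ≡false (+-monoʳ-≤ d l≤j)
                         | [m+n]∸[m+o]≡n∸o d j (size l) = refl
  leafAt-replaceLeaf-> s (nd l r) m j e m<j | inj₂ l≤m
    rewrite ≥⇒<ᵇ≡false l≤m | ≥⇒<ᵇ≡false (≤-trans l≤m (<⇒≤ m<j))
          | ≥⇒<ᵇ≡false (≤-trans (≤-trans l≤m (<⇒≤ m<j)) (m≤n+m j d))
          | +-∸-assoc d (≤-trans l≤m (<⇒≤ m<j)) =
    leafAt-replaceLeaf-> R r (m ∸ size l) (j ∸ size l) e (∸-monoˡ-< m<j l≤m)

  leafAt-replaceLeaf-≡ : ∀ s t m j {s′ x} → leafAt s t m ≡ just (s′ , x) → j ≤ d →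
    leafAt s (replaceLeaf f t m) (j + m) ≡ leafAt s′ (f x) j
  leafAt-replaceLeaf-≡ s (lf x)   zero j refl _ rewrite +-identityʳ j = refl
  leafAt-replaceLeaf-≡ s (nd l r) m    j e    j≤d with <-≤-connex m (size l)
  ... | inj₁ m<l rewrite <⇒<ᵇ≡true m<l | size-replaceLeaf L l m e
                       | <⇒<ᵇ≡true (+-mono-≤-< j≤d m<l) = leafAt-replaceLeaf-≡ L l m j e j≤d
  ... | inj₂ l≤m rewrite ≥⇒<ᵇ≡false l≤m | ≥⇒<ᵇ≡false (≤-trans l≤m (m≤n+m m j))
                       | +-∸-assoc j l≤m = leafAt-replaceLeaf-≡ R r (m ∸ size l) j e j≤d

  countᵇ-replaceLeaf : ∀ p s t m {s′ x} → leafAt s t m ≡ just (s′ , x) →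
    countᵇ p (leafInfo s (replaceLeaf f t m)) + countᵇ p [ (s′ , x) ]
      ≡ countᵇ p (leafInfo s t) + countᵇ p (leafInfo s′ (f x))
  countᵇ-replaceLeaf p s (lf x)   zero refl = +-comm (countᵇ p (leafInfo s (f x))) (countᵇ p [ (s , x) ])
  countᵇ-replaceLeaf p s (nd l r) m {s′} {x} e with <-≤-connex m (size l)
  ... | inj₁ m<l rewrite <⇒<ᵇ≡true m<l
                       | countᵇ-++ p (leafInfo L (replaceLeaf f l m)) (leafInfo R r)
                       | countᵇ-++ p (leafInfo L l) (leafInfo R r) = begin
    countᵇ p (leafInfo L (replaceLeaf f l m)) + n + c  ≡⟨ xy∙z≈xz∙y _ n c ⟩
    countᵇ p (leafInfo L (replaceLeaf f l m)) + c + n  ≡⟨ cong (_+ n) (countᵇ-replaceLeaf p L l m e) ⟩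
    countᵇ p (leafInfo L l) + c′ + n                   ≡⟨ xy∙z≈xz∙y _ c′ n ⟩
    countᵇ p (leafInfo L l) + n + c′                   ∎
    where
      n = countᵇ p (leafInfo R r)
      c = countᵇ p [ (s′ , x) ]
      c′ = countᵇ p (leafInfo s′ (f x))
  ... | inj₂ l≤m rewrite ≥⇒<ᵇ≡false l≤m
                       | countᵇ-++ p (leafInfo L l) (leafInfo R (replaceLeaf f r (m ∸ size l)))
                       | countᵇ-++ p (leafInfo L l) (leafInfo R r) = begin
    n + countᵇ p (leafInfo R (replaceLeaf f r (m ∸ size l))) + c  ≡⟨ +-assoc n _ c ⟩
    n + (countᵇ p (leafInfo R (replaceLeaf f r (m ∸ size l))) + c)
      ≡⟨ cong (n +_) (countᵇ-replaceLeaf p R r (m ∸ size l) e) ⟩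
    n + (countᵇ p (leafInfo R r) + c′)                             ≡⟨ +-assoc n _ c′ ⟨
    n + countᵇ p (leafInfo R r) + c′                               ∎
    where
      n = countᵇ p (leafInfo L l)
      c = countᵇ p [ (s′ , x) ]
      c′ = countᵇ p (leafInfo s′ (f x))

θS : Side → ℕ → BT → PT
θS L = θL
θS R = θR

sonCount : PT → ℕ
sonCount (pt _ cs) = length cs

incrHead : Path → Path
incrHead []      = []
incrHead (i ∷ p) = suc i ∷ p

leafPath : Side → ℕ → BT → ℕ → Path
leafPath s o (lf x)   m = []
leafPath L o (nd l r) m = if m <ᵇ size l then leafPath L o l m
                          else sonCount (θL o l) ∷ leafPath R (o + size l) r (m ∸ size l)
leafPath R o (nd l r) m = if m <ᵇ size l then 0 ∷ leafPath L o l m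
                          else incrHead (leafPath R (o + size l) r (m ∸ size l))

lookupCs-++ : ∀ cs ds i p {z} → lookupCs cs i p ≡ just z → lookupCs (cs ++ ds) i p ≡ just z
lookupCs-++ (c ∷ cs) ds zero    p e = e
lookupCs-++ (c ∷ cs) ds (suc i) p e = lookupCs-++ cs ds i p e

lookupCs-++⁻ : ∀ cs c i p {z} → lookupCs (cs ++ [ c ]) i p ≡ just z →
  lookupCs cs i p ≡ just z ⊎ lookupPT c p ≡ just z
lookupCs-++⁻ []       c zero    p e = inj₂ e
lookupCs-++⁻ (d ∷ cs) c zero    p e = inj₁ e
lookupCs-++⁻ (d ∷ cs) c (suc i) p e = lookupCs-++⁻ cs c i p e

lookupCs-last : ∀ cs c p → lookupCs (cs ++ [ c ]) (length cs) p ≡ lookupPT c p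
lookupCs-last []       c p = refl
lookupCs-last (d ∷ cs) c p = lookupCs-last cs c p

lookup-appendChild-old : ∀ T c p {z} → lookupPT T p ≡ just z → lookupPT (appendChild T c) p ≡ just z
lookup-appendChild-old (pt y cs) c []      e = e
lookup-appendChild-old (pt y cs) c (i ∷ p) e = lookupCs-++ cs [ c ] i p e

lookup-appendChild-new : ∀ T c p → lookupPT (appendChild T c) (sonCount T ∷ p) ≡ lookupPT c p
lookup-appendChild-new (pt y cs) c p = lookupCs-last cs c p

lookup-appendChild⁻ : ∀ T c q {z} → lookupPT (appendChild T c) q ≡ just z →
  lookupPT T q ≡ just z ⊎ Σ Path (λ q′ → lookupPT c q′ ≡ just z)
lookup-appendChild⁻ (pt y cs) c []      e = inj₁ e
lookup-appendChild⁻ (pt y cs) c (i ∷ q) e with lookupCs-++⁻ cs c i q e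
... | inj₁ e′ = inj₁ e′
... | inj₂ e′ = inj₂ (q , e′)

lookup-consChild-new : ∀ c T p → lookupPT (consChild c T) (0 ∷ p) ≡ lookupPT c p
lookup-consChild-new c (pt y cs) p = refl

lookup-consChild-old : ∀ c T p → lookupPT (consChild c T) (incrHead p) ≡ lookupPT T p
lookup-consChild-old c (pt y cs) []      = refl
lookup-consChild-old c (pt y cs) (i ∷ p) = refl

lookup-consChild⁻ : ∀ c T q {z} → lookupPT (consChild c T) q ≡ just z →
  Σ Path (λ q′ → lookupPT c q′ ≡ just z) ⊎ Σ Path (λ q′ → lookupPT T q′ ≡ just z)
lookup-consChild⁻ c (pt y cs) []          e = inj₂ ([] , e)
lookup-consChild⁻ c (pt y cs) (zero ∷ q)  e = inj₁ (q , e)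
lookup-consChild⁻ c (pt y cs) (suc i ∷ q) e = inj₂ (i ∷ q , e)

modifyCs-++ : ∀ i p G cs ds {z} → lookupCs cs i p ≡ just z → modifyCs i p G (cs ++ ds) ≡ modifyCs i p G cs ++ ds
modifyCs-++ zero    p G (c ∷ cs) ds e = refl
modifyCs-++ (suc i) p G (c ∷ cs) ds e = cong (c ∷_) (modifyCs-++ i p G cs ds e)

modifyCs-last : ∀ p G cs c → modifyCs (length cs) p G (cs ++ [ c ]) ≡ cs ++ [ modifyAt p G c ]
modifyCs-last p G []       c = refl
modifyCs-last p G (d ∷ cs) c = cong (d ∷_) (modifyCs-last p G cs c)

-- θL grows a vertex by a new last son, θR by a new first son.
CommutesWithSon : Side → (PT → PT) → Set
CommutesWithSon L G = ∀ T c → G (appendChild T c) ≡ appendChild (G T) c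
CommutesWithSon R G = ∀ c T → G (consChild c T) ≡ consChild c (G T)

modifyAt-appendChild-old : ∀ p G T c {z} → lookupPT T p ≡ just z → (p ≡ [] → CommutesWithSon L G) →
  modifyAt p G (appendChild T c) ≡ appendChild (modifyAt p G T) c
modifyAt-appendChild-old []      G T         c e comm = comm refl T c
modifyAt-appendChild-old (i ∷ p) G (pt y cs) c e comm = cong (pt y) (modifyCs-++ i p G cs [ c ] e)

modifyAt-appendChild-new : ∀ q G T c → modifyAt (sonCount T ∷ q) G (appendChild T c) ≡ appendChild T (modifyAt q G c)
modifyAt-appendChild-new q G (pt y cs) c = cong (pt y) (modifyCs-last q G cs c)

modifyAt-consChild-new : ∀ p G c T → modifyAt (0 ∷ p) G (consChild c T) ≡ consChild (modifyAt p G c) T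
modifyAt-consChild-new p G c (pt y cs) = refl

modifyAt-consChild-old : ∀ q G c T → (q ≡ [] → CommutesWithSon R G) →
  modifyAt (incrHead q) G (consChild c T) ≡ consChild c (modifyAt q G T)
modifyAt-consChild-old []      G c T         comm = comm refl c T
modifyAt-consChild-old (i ∷ q) G c (pt y cs) comm = refl

shiftCs-++ : ∀ i cs ds → shiftCs i (cs ++ ds) ≡ shiftCs i cs ++ shiftCs i ds
shiftCs-++ i []       ds = refl
shiftCs-++ i (c ∷ cs) ds = cong (shiftFrom i c ∷_) (shiftCs-++ i cs ds)

shiftFrom-appendChild : ∀ i T c → shiftFrom i (appendChild T c) ≡ appendChild (shiftFrom i T) (shiftFrom i c)
shiftFrom-appendChild i (pt (s , x , k) cs) c = cong (pt (s , x , shiftIdx i k)) (shiftCs-++ i cs [ c ])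

shiftFrom-consChild : ∀ i c T → shiftFrom i (consChild c T) ≡ consChild (shiftFrom i c) (shiftFrom i T)
shiftFrom-consChild i c (pt (s , x , k) cs) = refl

shiftFrom-θ-above : ∀ i s o t → i ≤ o → shiftFrom i (θS s o t) ≡ θS s (suc o) t
shiftFrom-θ-above i L o (lf x) i≤o rewrite ≥⇒<ᵇ≡false i≤o = refl
shiftFrom-θ-above i R o (lf x) i≤o rewrite ≥⇒<ᵇ≡false i≤o = refl
shiftFrom-θ-above i L o (nd l r) i≤o = trans (shiftFrom-appendChild i (θL o l) (θR (o + size l) r))
  (cong₂ appendChild (shiftFrom-θ-above i L o l i≤o)
                     (shiftFrom-θ-above i R (o + size l) r (≤-trans i≤o (m≤m+n o (size l)))))
shiftFrom-θ-above i R o (nd l r) i≤o = trans (shiftFrom-consChild i (θL o l) (θR (o + size l) r))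
  (cong₂ consChild (shiftFrom-θ-above i L o l i≤o)
                   (shiftFrom-θ-above i R (o + size l) r (≤-trans i≤o (m≤m+n o (size l)))))

shiftFrom-θ-below : ∀ i s o t → o + size t ≤ i → shiftFrom i (θS s o t) ≡ θS s o t
shiftFrom-θ-below i L o (lf x) o<i rewrite <⇒<ᵇ≡true (subst (_≤ i) (+-comm o 1) o<i) = refl
shiftFrom-θ-below i R o (lf x) o<i rewrite <⇒<ᵇ≡true (subst (_≤ i) (+-comm o 1) o<i) = refl
shiftFrom-θ-below i L o (nd l r) o+t≤i = trans (shiftFrom-appendChild i (θL o l) (θR (o + size l) r))
  (cong₂ appendChild (shiftFrom-θ-below i L o l (≤-trans (+-monoʳ-≤ o (m≤m+n (size l) (size r))) o+t≤i))
                     (shiftFrom-θ-below i R (o + size l) r (subst (_≤ i) (sym (+-assoc o (size l) (size r))) o+t≤i)))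
shiftFrom-θ-below i R o (nd l r) o+t≤i = trans (shiftFrom-consChild i (θL o l) (θR (o + size l) r))
  (cong₂ consChild (shiftFrom-θ-below i L o l (≤-trans (+-monoʳ-≤ o (m≤m+n (size l) (size r))) o+t≤i))
                   (shiftFrom-θ-below i R (o + size l) r (subst (_≤ i) (sym (+-assoc o (size l) (size r))) o+t≤i)))

mutual
  lookup-shiftFrom : ∀ i T p {s x k} → lookupPT T p ≡ just (s , x , k) →
    lookupPT (shiftFrom i T) p ≡ just (s , x , shiftIdx i k)
  lookup-shiftFrom i (pt _ cs) []      refl = refl
  lookup-shiftFrom i (pt _ cs) (j ∷ p) e    = lookupCs-shiftCs i cs j p e

  lookupCs-shiftCs : ∀ i cs j p {s x k} → lookupCs cs j p ≡ just (s , x , k) →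
    lookupCs (shiftCs i cs) j p ≡ just (s , x , shiftIdx i k)
  lookupCs-shiftCs i (c ∷ cs) zero    p e = lookup-shiftFrom i c p e
  lookupCs-shiftCs i (c ∷ cs) (suc j) p e = lookupCs-shiftCs i cs j p e

+-∸-offset : ∀ o {n m} → n ≤ m → o + n + (m ∸ n) ≡ o + m
+-∸-offset o n≤m = trans (+-assoc o _ _) (cong (o +_) (m+[n∸m]≡n n≤m))

lookup-θ-leafPath : ∀ s o t m {s′ x} → leafAt s t m ≡ just (s′ , x) →
  lookupPT (θS s o t) (leafPath s o t m) ≡ just (s′ , x , o + m)
lookup-θ-leafPath L o (lf y) zero refl rewrite +-identityʳ o = refl
lookup-θ-leafPath R o (lf y) zero refl rewrite +-identityʳ o = refl
lookup-θ-leafPath L o (nd l r) m {s′} {x} e with <-≤-connex m (size l)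
... | inj₁ m<l rewrite <⇒<ᵇ≡true m<l =
  lookup-appendChild-old (θL o l) (θR (o + size l) r) (leafPath L o l m) (lookup-θ-leafPath L o l m e)
... | inj₂ l≤m rewrite ≥⇒<ᵇ≡false l≤m = begin
  lookupPT (appendChild (θL o l) (θR (o + size l) r)) (sonCount (θL o l) ∷ leafPath R (o + size l) r (m ∸ size l))
    ≡⟨ lookup-appendChild-new (θL o l) (θR (o + size l) r) _ ⟩
  lookupPT (θR (o + size l) r) (leafPath R (o + size l) r (m ∸ size l))
    ≡⟨ lookup-θ-leafPath R (o + size l) r (m ∸ size l) e ⟩
  just (s′ , x , o + size l + (m ∸ size l))
    ≡⟨ cong (λ k → just (s′ , x , k)) (+-∸-offset o l≤m) ⟩
  just (s′ , x , o + m) ∎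
lookup-θ-leafPath R o (nd l r) m {s′} {x} e with <-≤-connex m (size l)
... | inj₁ m<l rewrite <⇒<ᵇ≡true m<l =
  trans (lookup-consChild-new (θL o l) (θR (o + size l) r) _) (lookup-θ-leafPath L o l m e)
... | inj₂ l≤m rewrite ≥⇒<ᵇ≡false l≤m = begin
  lookupPT (consChild (θL o l) (θR (o + size l) r)) (incrHead (leafPath R (o + size l) r (m ∸ size l)))
    ≡⟨ lookup-consChild-old (θL o l) (θR (o + size l) r) _ ⟩
  lookupPT (θR (o + size l) r) (leafPath R (o + size l) r (m ∸ size l))
    ≡⟨ lookup-θ-leafPath R (o + size l) r (m ∸ size l) e ⟩
  just (s′ , x , o + size l + (m ∸ size l))
    ≡⟨ cong (λ k → just (s′ , x , k)) (+-∸-offset o l≤m) ⟩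
  just (s′ , x , o + m) ∎

LeafOrigin : Side → ℕ → BT → Side × Bool → ℕ → Set
LeafOrigin s o t y j = Σ ℕ λ m → (j ≡ o + m) × (leafAt s t m ≡ just y)

leafOrigin-left : ∀ s o l r {y j} → LeafOrigin L o l y j → LeafOrigin s o (nd l r) y j
leafOrigin-left s o l r (m , j≡o+m , e) = m , j≡o+m , trans (leafAt-nd-< s l r (leafAt⇒<size L l m e)) e

leafOrigin-right : ∀ s o l r {y j} → LeafOrigin R (o + size l) r y j → LeafOrigin s o (nd l r) y j
leafOrigin-right s o l r (m , j≡ , e) = size l + m , trans j≡ (+-assoc o (size l) m) ,
  trans (leafAt-nd-≥ s l r (m≤m+n (size l) m)) (trans (cong (leafAt R r) (m+n∸m≡n (size l) m)) e)

lookup-θ⁻ : ∀ s o t q {s′ x j} → lookupPT (θS s o t) q ≡ just (s′ , x , j) → LeafOrigin s o t (s′ , x) j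
lookup-θ⁻ L o (lf y) [] refl = 0 , sym (+-identityʳ o) , refl
lookup-θ⁻ R o (lf y) [] refl = 0 , sym (+-identityʳ o) , refl
lookup-θ⁻ L o (nd l r) q e with lookup-appendChild⁻ (θL o l) (θR (o + size l) r) q e
... | inj₁ e′        = leafOrigin-left L o l r (lookup-θ⁻ L o l q e′)
... | inj₂ (q′ , e′) = leafOrigin-right L o l r (lookup-θ⁻ R (o + size l) r q′ e′)
lookup-θ⁻ R o (nd l r) q e with lookup-consChild⁻ (θL o l) (θR (o + size l) r) q e
... | inj₁ (q′ , e′) = leafOrigin-left R o l r (lookup-θ⁻ L o l q′ e′)
... | inj₂ (q′ , e′) = leafOrigin-right R o l r (lookup-θ⁻ R (o + size l) r q′ e′)

leafPath≡[]⇒side : ∀ s o t m {s′ x} → leafAt s t m ≡ just (s′ , x) → leafPath s o t m ≡ [] → s′ ≡ s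
leafPath≡[]⇒side s o (lf y)   zero refl _ = refl
leafPath≡[]⇒side L o (nd l r) m    e    p≡[] with <-≤-connex m (size l)
... | inj₁ m<l rewrite <⇒<ᵇ≡true m<l = leafPath≡[]⇒side L o l m e p≡[]
... | inj₂ l≤m rewrite ≥⇒<ᵇ≡false l≤m with () ← p≡[]
leafPath≡[]⇒side R o (nd l r) m    e    p≡[] with <-≤-connex m (size l)
... | inj₁ m<l rewrite <⇒<ᵇ≡true m<l with () ← p≡[]
... | inj₂ l≤m rewrite ≥⇒<ᵇ≡false l≤m =
  leafPath≡[]⇒side R (o + size l) r (m ∸ size l) e (incrHead≡[] p≡[])
  where
    incrHead≡[] : ∀ {p} → incrHead p ≡ [] → p ≡ []
    incrHead≡[] {[]} _ = refl

-- Replacing the leaf at absolute position k by f x acts on θ as a relabelling σ of the whole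
-- tree (d = size (f x) - 1 new positions are opened after k) followed by an operation G at the
-- vertex of that leaf.
module Surgery (f : Bool → BT) (d : ℕ) (size-f : ∀ x → size (f x) ≡ suc d) (k : ℕ)
  (σ : PT → PT)
  (σ-appendChild : ∀ T c → σ (appendChild T c) ≡ appendChild (σ T) (σ c))
  (σ-consChild : ∀ c T → σ (consChild c T) ≡ consChild (σ c) (σ T))
  (σ-below : ∀ s o t → o + size t ≤ k → σ (θS s o t) ≡ θS s o t)
  (σ-above : ∀ s o t → k < o → σ (θS s o t) ≡ θS s (d + o) t)
  (σ-defined : ∀ T p {z} → lookupPT T p ≡ just z → Σ Label λ z′ → lookupPT (σ T) p ≡ just z′)
  (G : PT → PT) where

  open Replacement f d size-f using (size-replaceLeaf)

  private
    shifted-right-part : ∀ o l r {m y} → m < size l → leafAt L l m ≡ just y → o + m ≡ k →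
      θR (o + size (replaceLeaf f l m)) r ≡ σ (θR (o + size l) r)
    shifted-right-part o l r {m} m<l e o+m≡k = begin
      θR (o + size (replaceLeaf f l m)) r ≡⟨ cong (λ n → θR (o + n) r) (size-replaceLeaf L l _ e) ⟩
      θR (o + (d + size l)) r             ≡⟨ cong (λ n → θR n r) (x∙yz≈y∙xz o d (size l)) ⟩
      θR (d + (o + size l)) r
        ≡⟨ σ-above R (o + size l) r (subst (_< o + size l) o+m≡k (+-monoʳ-< o m<l)) ⟨
      σ (θR (o + size l) r)               ∎

    unshifted-left : ∀ o l {m} → size l ≤ m → o + m ≡ k → σ (θL o l) ≡ θL o l
    unshifted-left o l l≤m o+m≡k = σ-below L o l (subst (o + size l ≤_) o+m≡k (+-monoʳ-≤ o l≤m))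

  θ-replaceLeaf : ∀ s o t m {s′ x} → leafAt s t m ≡ just (s′ , x) → o + m ≡ k →
    CommutesWithSon s′ G → θS s′ k (f x) ≡ G (σ (θS s′ k (lf x))) →
    θS s o (replaceLeaf f t m) ≡ modifyAt (leafPath s o t m) G (σ (θS s o t))
  θ-replaceLeaf s o (lf y) zero refl o+0≡k _ leaf =
    subst (λ n → θS s n (f y) ≡ G (σ (θS s n (lf y)))) (trans (sym o+0≡k) (+-identityʳ o)) leaf
  θ-replaceLeaf L o (nd l r) m {s′} e o+m≡k comm leaf with <-≤-connex m (size l)
  ... | inj₁ m<l rewrite <⇒<ᵇ≡true m<l = begin
    appendChild (θL o (replaceLeaf f l m)) (θR (o + size (replaceLeaf f l m)) r)
      ≡⟨ cong₂ appendChild (θ-replaceLeaf L o l m e o+m≡k comm leaf) (shifted-right-part o l r m<l e o+m≡k) ⟩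
    appendChild (modifyAt P G (σ A)) (σ B)
      ≡⟨ modifyAt-appendChild-old P G (σ A) (σ B) (proj₂ (σ-defined A P (lookup-θ-leafPath L o l m e)))
           (λ P≡[] → subst (λ s → CommutesWithSon s G) (leafPath≡[]⇒side L o l m e P≡[]) comm) ⟨
    modifyAt P G (appendChild (σ A) (σ B))
      ≡⟨ cong (modifyAt P G) (σ-appendChild A B) ⟨
    modifyAt P G (σ (appendChild A B)) ∎
    where
      P = leafPath L o l m
      A = θL o l
      B = θR (o + size l) r
  ... | inj₂ l≤m rewrite ≥⇒<ᵇ≡false l≤m = begin
    appendChild A (θR o′ (replaceLeaf f r m′))
      ≡⟨ cong (appendChild A) (θ-replaceLeaf R o′ r m′ e (trans (+-∸-offset o l≤m) o+m≡k) comm leaf) ⟩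
    appendChild A (modifyAt Q G (σ B))
      ≡⟨ modifyAt-appendChild-new Q G A (σ B) ⟨
    modifyAt (sonCount A ∷ Q) G (appendChild A (σ B))
      ≡⟨ cong (λ T → modifyAt (sonCount A ∷ Q) G (appendChild T (σ B))) (unshifted-left o l l≤m o+m≡k) ⟨
    modifyAt (sonCount A ∷ Q) G (appendChild (σ A) (σ B))
      ≡⟨ cong (modifyAt (sonCount A ∷ Q) G) (σ-appendChild A B) ⟨
    modifyAt (sonCount A ∷ Q) G (σ (appendChild A B)) ∎
    where
      o′ = o + size l
      m′ = m ∸ size l
      Q = leafPath R o′ r m′
      A = θL o l
      B = θR o′ r
  θ-replaceLeaf R o (nd l r) m {s′} e o+m≡k comm leaf with <-≤-connex m (size l)
  ... | inj₁ m<l rewrite <⇒<ᵇ≡true m<l = begin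
    consChild (θL o (replaceLeaf f l m)) (θR (o + size (replaceLeaf f l m)) r)
      ≡⟨ cong₂ consChild (θ-replaceLeaf L o l m e o+m≡k comm leaf) (shifted-right-part o l r m<l e o+m≡k) ⟩
    consChild (modifyAt P G (σ A)) (σ B)
      ≡⟨ modifyAt-consChild-new P G (σ A) (σ B) ⟨
    modifyAt (0 ∷ P) G (consChild (σ A) (σ B))
      ≡⟨ cong (modifyAt (0 ∷ P) G) (σ-consChild A B) ⟨
    modifyAt (0 ∷ P) G (σ (consChild A B)) ∎
    where
      P = leafPath L o l m
      A = θL o l
      B = θR (o + size l) r
  ... | inj₂ l≤m rewrite ≥⇒<ᵇ≡false l≤m = begin
    consChild A (θR o′ (replaceLeaf f r m′))
      ≡⟨ cong (consChild A) (θ-replaceLeaf R o′ r m′ e (trans (+-∸-offset o l≤m) o+m≡k) comm leaf) ⟩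
    consChild A (modifyAt Q G (σ B))
      ≡⟨ modifyAt-consChild-old Q G A (σ B)
           (λ Q≡[] → subst (λ s → CommutesWithSon s G) (leafPath≡[]⇒side R o′ r m′ e Q≡[]) comm) ⟨
    modifyAt (incrHead Q) G (consChild A (σ B))
      ≡⟨ cong (λ T → modifyAt (incrHead Q) G (consChild T (σ B))) (unshifted-left o l l≤m o+m≡k) ⟨
    modifyAt (incrHead Q) G (consChild (σ A) (σ B))
      ≡⟨ cong (modifyAt (incrHead Q) G) (σ-consChild A B) ⟨
    modifyAt (incrHead Q) G (σ (consChild A B)) ∎
    where
      o′ = o + size l
      m′ = m ∸ size l
      Q = leafPath R o′ r m′
      A = θL o l
      B = θR o′ r

module Graft = Replacement (λ _ → B₁) 1 (λ _ → refl)
module Inactivation = Replacement (λ _ → lf false) 0 (λ _ → refl)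

graft : BT → ℕ → BT
graft = replaceLeaf (λ _ → B₁)

inactivateLeaf : BT → ℕ → BT
inactivateLeaf = replaceLeaf (λ _ → lf false)

shiftFrom-defined : ∀ i T p {z} → lookupPT T p ≡ just z →
  Σ Label λ z′ → lookupPT (shiftFrom i T) p ≡ just z′
shiftFrom-defined i T p e = _ , lookup-shiftFrom i T p e

θ-graft-left : ∀ t m → leafAt L t m ≡ just (L , true) →
  θ (graft t m) ≡ addLeftmost (leafPath L 0 t m) (R , true , suc m) (shiftFrom (suc m) (θ t))
θ-graft-left t m e =
  Surgery.θ-replaceLeaf (λ _ → B₁) 1 (λ _ → refl) m (shiftFrom (suc m))
    (shiftFrom-appendChild (suc m)) (shiftFrom-consChild (suc m))
    (λ s o t o+t≤m → shiftFrom-θ-below (suc m) s o t (m≤n⇒m≤1+n o+t≤m))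
    (shiftFrom-θ-above (suc m))
    (shiftFrom-defined (suc m)) (addLeftmost [] (R , true , suc m))
    L 0 t m e refl (λ { (pt _ _) c → refl }) leaf
  where
    leaf : θL m B₁ ≡ addLeftmost [] (R , true , suc m) (shiftFrom (suc m) (θL m (lf true)))
    leaf rewrite +-comm m 1 | <⇒<ᵇ≡true (n<1+n m) = refl

θ-graft-right : ∀ t m → leafAt L t m ≡ just (R , true) →
  θ (graft t m) ≡ addRightmost (leafPath L 0 t m) (L , true , m) (shiftFrom m (θ t))
θ-graft-right t m e =
  Surgery.θ-replaceLeaf (λ _ → B₁) 1 (λ _ → refl) m (shiftFrom m)
    (shiftFrom-appendChild m) (shiftFrom-consChild m)
    (shiftFrom-θ-below m)
    (λ s o t m<o → shiftFrom-θ-above m s o t (<⇒≤ m<o))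
    (shiftFrom-defined m) (addRightmost [] (L , true , m))
    L 0 t m e refl (λ { c (pt _ _) → refl }) leaf
  where
    leaf : θR m B₁ ≡ addRightmost [] (L , true , m) (shiftFrom m (θR m (lf true)))
    leaf rewrite +-comm m 1 | ≥⇒<ᵇ≡false (≤-refl {m}) = refl

θ-inactivateLeaf : ∀ t m {s x} → leafAt L t m ≡ just (s , x) →
  θ (inactivateLeaf t m) ≡ inactivate (leafPath L 0 t m) (θ t)
θ-inactivateLeaf t m {s} e =
  Surgery.θ-replaceLeaf (λ _ → lf false) 0 (λ _ → refl) m (λ T → T)
    (λ _ _ → refl) (λ _ _ → refl) (λ _ _ _ _ → refl) (λ _ _ _ _ → refl) (λ _ _ e → _ , e)
    (inactivate []) L 0 t m e refl (commutes s) (leaf s)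
  where
    commutes : ∀ s → CommutesWithSon s (inactivate [])
    commutes L (pt _ _) c = refl
    commutes R c (pt _ _) = refl
    leaf : ∀ s {x} → θS s m (lf false) ≡ inactivate [] (θS s m (lf x))
    leaf L = refl
    leaf R = refl

ActiveAt : Side → BT → ℕ → Set
ActiveAt s t j = leafAt L t j ≡ just (s , true)

ActiveLeftUpTo : BT → ℕ → Set
ActiveLeftUpTo t m = ∀ j → ActiveAt L t j → j ≤ m

ActiveRightFrom : BT → ℕ → Set
ActiveRightFrom t m = ∀ j → ActiveAt R t j → m ≤ j

Separated : BT → Set
Separated t = ∀ i j → ActiveAt L t i → ActiveAt R t j → i < j

separated : ∀ t m → ActiveLeftUpTo t m × ActiveRightFrom t (suc m) → Separated t
separated t m (left , right) i j i-active j-active = ≤-trans (s≤s (left i i-active)) (right j j-active)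

L≢R : ∀ {x y : Bool} → _≡_ {A = Maybe (Side × Bool)} (just (L , x)) (just (R , y)) → ⊥
L≢R ()

graft-separates : ∀ t m {y} → leafAt L t m ≡ just y → ActiveLeftUpTo t m → ActiveRightFrom t m →
  ActiveLeftUpTo (graft t m) m × ActiveRightFrom (graft t m) (suc m)
graft-separates t m e left right = left′ , right′
  where
    left′ : ActiveLeftUpTo (graft t m) m
    left′ j active with ≤-<-connex j m
    ... | inj₁ j≤m = j≤m
    left′ (suc j) active | inj₂ (s≤s m≤j) with m≤n⇒m<n∨m≡n m≤j
    ... | inj₁ m<j = ⊥-elim (<⇒≱ m<j (left j (trans (sym (Graft.leafAt-replaceLeaf-> L t m j e m<j)) active)))
    ... | inj₂ refl = ⊥-elim (L≢R (trans (sym active) (Graft.leafAt-replaceLeaf-≡ L t m 1 e ≤-refl)))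
    right′ : ActiveRightFrom (graft t m) (suc m)
    right′ j active with <-≤-connex m j
    ... | inj₁ m<j = m<j
    ... | inj₂ j≤m with m≤n⇒m<n∨m≡n j≤m
    ...   | inj₁ j<m = ⊥-elim (<⇒≱ j<m (right j (trans (sym (Graft.leafAt-replaceLeaf-< L t m j e j<m)) active)))
    ...   | inj₂ refl = ⊥-elim (L≢R (trans (sym (Graft.leafAt-replaceLeaf-≡ L t j 0 e z≤n)) active))

active-inactivateLeaf : ∀ t m s j {y} → leafAt L t m ≡ just y → ActiveAt s (inactivateLeaf t m) j → ActiveAt s t j
active-inactivateLeaf t m s j e active with <-cmp j m
... | tri< j<m _ _ = trans (sym (Inactivation.leafAt-replaceLeaf-< L t m j e j<m)) active
... | tri> _ _ m<j = trans (sym (Inactivation.leafAt-replaceLeaf-> L t m j e m<j)) active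
active-inactivateLeaf t m s j e active | tri≈ _ refl _
  with () ← trans (sym (Inactivation.leafAt-replaceLeaf-≡ L t j 0 e z≤n)) active

inactivateLeaf-separated : ∀ t m {y} → leafAt L t m ≡ just y → Separated t → Separated (inactivateLeaf t m)
inactivateLeaf-separated t m e sep i j i-active j-active =
  sep i j (active-inactivateLeaf t m L i e i-active) (active-inactivateLeaf t m R j e j-active)

activeCount : Side → BT → ℕ
activeCount s t = countᵇ (isActive s) (leaves t)

isActive-true : ∀ s y → isActive s y ≡ true → y ≡ (s , true)
isActive-true L (L , true) _ = refl
isActive-true R (R , true) _ = refl

LastActiveLeft : BT → ℕ → Set
LastActiveLeft t m = ActiveAt L t m × ActiveLeftUpTo t m

FirstActiveRight : BT → ℕ → Set
FirstActiveRight t m = ActiveAt R t m × ActiveRightFrom t m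

lastActiveLeft : ∀ t → activeCount L t ≢ 0 →
  Σ ℕ λ m → (lastIndex (isActive L) (leaves t) ≡ just m) × LastActiveLeft t m
lastActiveLeft t c≢0 with lastIndex (isActive L) (leaves t) in eq
... | nothing with countᵇ-witness (isActive L) (leaves t) c≢0
...   | j , y , h , py with () ← trans (sym py) (lastIndex-nothing (isActive L) (leaves t) eq j h)
lastActiveLeft t c≢0 | just m with lastIndex-just (isActive L) (leaves t) eq
... | (y , h , py) , maximal = m , refl ,
  trans (sym (nth-leafInfo L t m)) (trans h (cong just (isActive-true L y py))) ,
  λ j active → maximal j (trans (nth-leafInfo L t j) active) refl

firstActiveRight : ∀ t → activeCount R t ≢ 0 →
  Σ ℕ λ m → (firstIndex (isActive R) (leaves t) ≡ just m) × FirstActiveRight t m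
firstActiveRight t c≢0 with firstIndex (isActive R) (leaves t) in eq
... | nothing with countᵇ-witness (isActive R) (leaves t) c≢0
...   | j , y , h , py with () ← trans (sym py) (firstIndex-nothing (isActive R) (leaves t) eq j h)
firstActiveRight t c≢0 | just m with firstIndex-just (isActive R) (leaves t) eq
... | (y , h , py) , minimal = m , refl ,
  trans (sym (nth-leafInfo L t m)) (trans h (cong just (isActive-true R y py))) ,
  λ j active → minimal j (trans (nth-leafInfo L t j) active) refl

θ-active : ∀ t s {P : ℕ → Set} → (∀ j → ActiveAt s t j → P j) →
  ∀ q j → lookupPT (θ t) q ≡ just (s , true , j) → P j
θ-active t s bound q j e with lookup-θ⁻ L 0 t q e
... | m , refl , active = bound m active

θ-lastActiveLeft : ∀ t m → LastActiveLeft t m → IsLastActiveLeft (θ t) (leafPath L 0 t m) m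
θ-lastActiveLeft t m (active , maximal) = lookup-θ-leafPath L 0 t m active , θ-active t L maximal

θ-firstActiveRight : ∀ t m → FirstActiveRight t m → IsFirstActiveRight (θ t) (leafPath L 0 t m) m
θ-firstActiveRight t m (active , minimal) = lookup-θ-leafPath L 0 t m active , θ-active t R minimal

graft-lastActiveLeft : ∀ t m → Separated t → LastActiveLeft t m →
  ActiveLeftUpTo (graft t m) m × ActiveRightFrom (graft t m) (suc m)
graft-lastActiveLeft t m sep (active , maximal) =
  graft-separates t m active maximal (λ j j-active → <⇒≤ (sep m j active j-active))

graft-firstActiveRight : ∀ t m → Separated t → FirstActiveRight t m →
  ActiveLeftUpTo (graft t m) m × ActiveRightFrom (graft t m) (suc m)
graft-firstActiveRight t m sep (active , minimal) =
  graft-separates t m active (λ j j-active → <⇒≤ (sep j m j-active active)) minimal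

step-invariant : ∀ t x → Separated t → activeCount L t ≢ 0 → activeCount R t ≢ 0 →
  Separated (step t x) ×
  (activeCount L (step t x) + count bbar [ x ] ≡ activeCount L t + count b [ x ]) ×
  (activeCount R (step t x) + count abar [ x ] ≡ activeCount R t + count a [ x ])
step-invariant t a sep cL≢0 _ with lastActiveLeft t cL≢0
... | m , eq , last@(active , _) rewrite eq | modifyLeaf≡replaceLeaf m (λ _ → B₁) t =
  separated (graft t m) m (graft-lastActiveLeft t m sep last) ,
  cong (_+ 0) (+-cancelʳ-≡ 1 _ _ (Graft.countᵇ-replaceLeaf (isActive L) L t m active)) ,
  Graft.countᵇ-replaceLeaf (isActive R) L t m active
step-invariant t b sep _ cR≢0 with firstActiveRight t cR≢0
... | m , eq , first@(active , _) rewrite eq | modifyLeaf≡replaceLeaf m (λ _ → B₁) t =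
  separated (graft t m) m (graft-firstActiveRight t m sep first) ,
  Graft.countᵇ-replaceLeaf (isActive L) L t m active ,
  cong (_+ 0) (+-cancelʳ-≡ 1 _ _ (Graft.countᵇ-replaceLeaf (isActive R) L t m active))
step-invariant t abar sep _ cR≢0 with firstActiveRight t cR≢0
... | m , eq , (active , _) rewrite eq | modifyLeaf≡replaceLeaf m (λ _ → lf false) t =
  inactivateLeaf-separated t m active sep ,
  Inactivation.countᵇ-replaceLeaf (isActive L) L t m active ,
  Inactivation.countᵇ-replaceLeaf (isActive R) L t m active
step-invariant t bbar sep cL≢0 _ with lastActiveLeft t cL≢0
... | m , eq , (active , _) rewrite eq | modifyLeaf≡replaceLeaf m (λ _ → lf false) t =
  inactivateLeaf-separated t m active sep ,
  Inactivation.countᵇ-replaceLeaf (isActive L) L t m active ,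
  Inactivation.countᵇ-replaceLeaf (isActive R) L t m active

-- The hole in the type of λ₁-loop≡foldl is solved by its use in λ₁≡foldl: it stands for the
-- local loop of λ₁, which cannot be named from outside Defs.
mutual
  λ₁≡foldl : ∀ w → λ₁ w ≡ foldl step B₁ w
  λ₁≡foldl []      = refl
  λ₁≡foldl (x ∷ u) with x ∷ u | step B₁ x
  ... | w | t = λ₁-loop≡foldl w t u

  λ₁-loop≡foldl : (w : List Letter) (t : BT) (u : List Letter) → _ ≡ foldl step t u
  λ₁-loop≡foldl w t []      = refl
  λ₁-loop≡foldl w t (x ∷ u) = λ₁-loop≡foldl w (step t x) u

λ₁-∷ʳ : ∀ w x → λ₁ (w ++ [ x ]) ≡ step (λ₁ w) x
λ₁-∷ʳ w x = begin
  λ₁ (w ++ [ x ])             ≡⟨ λ₁≡foldl (w ++ [ x ]) ⟩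
  foldl step B₁ (w ++ [ x ])  ≡⟨ foldl-∷ʳ step B₁ x w ⟩
  step (foldl step B₁ w) x    ≡⟨ cong (λ t → step t x) (λ₁≡foldl w) ⟨
  step (λ₁ w) x               ∎

count-++ : ∀ x u v → count x (u ++ v) ≡ count x u + count x v
count-++ x []      v = refl
count-++ x (y ∷ u) v with eqL x y
... | true  = cong suc (count-++ x u v)
... | false = count-++ x u v

prefixShuffle-∷ʳ⁻ : ∀ w x → PrefixShuffle (w ++ [ x ]) → PrefixShuffle w
prefixShuffle-∷ʳ⁻ w x ps u v w≡uv = ps u (v ++ [ x ]) (trans (cong (_++ [ x ]) w≡uv) (++-assoc u v [ x ]))

prefixShuffle-counts : ∀ w → PrefixShuffle w → (count abar w ≤ count a w) × (count bbar w ≤ count b w)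
prefixShuffle-counts w ps = ps w [] (sym (++-identityʳ w))

balance-≢0 : ∀ {n c̄ c} → n + c̄ ≡ suc c → c̄ ≤ c → n ≢ 0
balance-≢0 n+c̄≡1+c c̄≤c refl = <⇒≱ (≤-reflexive (sym n+c̄≡1+c)) c̄≤c

balance-∷ʳ : ∀ {n n′ c c̄ δ δ̄} → n′ + δ̄ ≡ n + δ → n + c̄ ≡ suc c → n′ + (c̄ + δ̄) ≡ suc (c + δ)
balance-∷ʳ {n} {n′} {c} {c̄} {δ} {δ̄} step-eq balance = begin
  n′ + (c̄ + δ̄) ≡⟨ x∙yz≈xz∙y n′ c̄ δ̄ ⟩
  n′ + δ̄ + c̄   ≡⟨ cong (_+ c̄) step-eq ⟩
  n + δ + c̄    ≡⟨ +-assoc n δ c̄ ⟩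
  n + (δ + c̄)  ≡⟨ x∙yz≈xz∙y n δ c̄ ⟩
  n + c̄ + δ    ≡⟨ cong (_+ δ) balance ⟩
  suc (c + δ)  ∎

record Invariant (w : List Letter) : Set where
  field
    separated-λ₁  : Separated (λ₁ w)
    left-balance  : activeCount L (λ₁ w) + count bbar w ≡ suc (count b w)
    right-balance : activeCount R (λ₁ w) + count abar w ≡ suc (count a w)

B₁-separated : Separated B₁
B₁-separated zero zero    _ ()
B₁-separated zero (suc j) _ _ = s≤s z≤n
B₁-separated (suc zero) j () _

invariant-∷ʳ : ∀ w x → (count abar w ≤ count a w) × (count bbar w ≤ count b w) →
  Invariant w → Invariant (w ++ [ x ])
invariant-∷ʳ w x (ā≤a , b̄≤b) inv = record
  { separated-λ₁  = subst Separated (sym (λ₁-∷ʳ w x)) sep′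
  ; left-balance  = balanced L b bbar left′ left-balance
  ; right-balance = balanced R a abar right′ right-balance
  }
  where
    open Invariant inv
    t = λ₁ w
    step-facts = step-invariant t x separated-λ₁ (balance-≢0 left-balance b̄≤b) (balance-≢0 right-balance ā≤a)
    sep′ = proj₁ step-facts
    left′ = proj₁ (proj₂ step-facts)
    right′ = proj₂ (proj₂ step-facts)
    balanced : ∀ s y y′ → activeCount s (step t x) + count y′ [ x ] ≡ activeCount s t + count y [ x ] →
      activeCount s t + count y′ w ≡ suc (count y w) →
      activeCount s (λ₁ (w ++ [ x ])) + count y′ (w ++ [ x ]) ≡ suc (count y (w ++ [ x ]))
    balanced s y y′ step-eq balance
      rewrite λ₁-∷ʳ w x | count-++ y′ w [ x ] | count-++ y w [ x ] =
      balance-∷ʳ {n′ = activeCount s (step t x)} {δ̄ = count y′ [ x ]} step-eq balance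

invariant : ∀ w → PrefixShuffle w → Invariant w
invariant w = go (reverseView w)
  where
    go : ∀ {w} → Reverse w → PrefixShuffle w → Invariant w
    go []              _  = record { separated-λ₁ = B₁-separated ; left-balance = refl ; right-balance = refl }
    go (u ∶ rs ∶ʳ x) ps = invariant-∷ʳ u x (prefixShuffle-counts u ps′) (go rs ps′)
      where ps′ = prefixShuffle-∷ʳ⁻ u x ps

AddsFirstActiveRight : PT → PT → Set
AddsFirstActiveRight T T′ = Σ Path λ p → Σ ℕ λ k → IsLastActiveLeft T p k × Σ ℕ λ i →
  (T′ ≡ addLeftmost p (R , true , i) (shiftFrom i T)) ×
  (∀ (q : Path) (j : ℕ) → lookupPT T′ q ≡ just (R , true , j) → i ≤ j)

AddsLastActiveLeft : PT → PT → Set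
AddsLastActiveLeft T T′ = Σ Path λ p → Σ ℕ λ k → IsFirstActiveRight T p k × Σ ℕ λ i →
  (T′ ≡ addRightmost p (L , true , i) (shiftFrom i T)) ×
  (∀ (q : Path) (j : ℕ) → lookupPT T′ q ≡ just (L , true , j) → j ≤ i)

InactivatesFirstActiveRight : PT → PT → Set
InactivatesFirstActiveRight T T′ = Σ Path λ p → Σ ℕ λ k → IsFirstActiveRight T p k × (T′ ≡ inactivate p T)

InactivatesLastActiveLeft : PT → PT → Set
InactivatesLastActiveLeft T T′ = Σ Path λ p → Σ ℕ λ k → IsLastActiveLeft T p k × (T′ ≡ inactivate p T)

θ-step-a : ∀ t → Separated t → activeCount L t ≢ 0 → AddsFirstActiveRight (θ t) (θ (step t a))
θ-step-a t sep c≢0 with lastActiveLeft t c≢0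
... | m , eq , last@(active , _) rewrite eq | modifyLeaf≡replaceLeaf m (λ _ → B₁) t =
  leafPath L 0 t m , m , θ-lastActiveLeft t m last , suc m , θ-graft-left t m active ,
  θ-active (graft t m) R (proj₂ (graft-lastActiveLeft t m sep last))

θ-step-b : ∀ t → Separated t → activeCount R t ≢ 0 → AddsLastActiveLeft (θ t) (θ (step t b))
θ-step-b t sep c≢0 with firstActiveRight t c≢0
... | m , eq , first@(active , _) rewrite eq | modifyLeaf≡replaceLeaf m (λ _ → B₁) t =
  leafPath L 0 t m , m , θ-firstActiveRight t m first , m , θ-graft-right t m active ,
  θ-active (graft t m) L (proj₁ (graft-firstActiveRight t m sep first))

θ-step-abar : ∀ t → activeCount R t ≢ 0 → InactivatesFirstActiveRight (θ t) (θ (step t abar))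
θ-step-abar t c≢0 with firstActiveRight t c≢0
... | m , eq , first@(active , _) rewrite eq | modifyLeaf≡replaceLeaf m (λ _ → lf false) t =
  leafPath L 0 t m , m , θ-firstActiveRight t m first , θ-inactivateLeaf t m active

θ-step-bbar : ∀ t → activeCount L t ≢ 0 → InactivatesLastActiveLeft (θ t) (θ (step t bbar))
θ-step-bbar t c≢0 with lastActiveLeft t c≢0
... | m , eq , last@(active , _) rewrite eq | modifyLeaf≡replaceLeaf m (λ _ → lf false) t =
  leafPath L 0 t m , m , θ-lastActiveLeft t m last , θ-inactivateLeaf t m active

lemma10 : (w : List Letter) → PrefixShuffle w →
    -- (i)
    (Σ Path λ p → Σ ℕ λ k → IsLastActiveLeft (𝒯 w) p k ×
      Σ ℕ λ i →
        (𝒯 (w ++ [ a ]) ≡ addLeftmost p (R , true , i) (shiftFrom i (𝒯 w))) ×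
        (∀ (q : Path) (j : ℕ) → lookupPT (𝒯 (w ++ [ a ])) q ≡ just (R , true , j) → i ≤ j))
    ×
    -- (ii)
    (Σ Path λ p → Σ ℕ λ k → IsFirstActiveRight (𝒯 w) p k ×
      Σ ℕ λ i →
        (𝒯 (w ++ [ b ]) ≡ addRightmost p (L , true , i) (shiftFrom i (𝒯 w))) ×
        (∀ (q : Path) (j : ℕ) → lookupPT (𝒯 (w ++ [ b ])) q ≡ just (L , true , j) → j ≤ i))
    ×
    -- (iii)
    (Σ Path λ p → Σ ℕ λ k → IsFirstActiveRight (𝒯 w) p k ×
      (𝒯 (w ++ [ abar ]) ≡ inactivate p (𝒯 w)))
    ×
    -- (iv)
    (Σ Path λ p → Σ ℕ λ k → IsLastActiveLeft (𝒯 w) p k ×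
      (𝒯 (w ++ [ bbar ]) ≡ inactivate p (𝒯 w)))
lemma10 w ps rewrite λ₁-∷ʳ w a | λ₁-∷ʳ w b | λ₁-∷ʳ w abar | λ₁-∷ʳ w bbar =
  θ-step-a t separated-λ₁ left≢0 , θ-step-b t separated-λ₁ right≢0 ,
  θ-step-abar t right≢0 , θ-step-bbar t left≢0
  where
    open Invariant (invariant w ps)
    t = λ₁ w
    left≢0 = balance-≢0 left-balance (proj₂ (prefixShuffle-counts w ps))
    right≢0 = balance-≢0 right-balance (proj₁ (prefixShuffle-counts w ps))
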